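{- Let $G$ be a connected graph (of order at least $2$). Then $\gamma_{tR}(G)=5$ if and only if $\gamma_t(G)=3$ and there exist a minimum dominating set $S$ of $G$ and a minimum total dominating set $T$ of $G$ such that $S\subset T$.
   Context: All graphs are finite and simple. A dominating set of $G$ is a set $S$ such that every vertex outside $S$ has a neighbour in $S$; $\gamma(G)$ is the minimum size of a dominating set (a minimum one is a $\gamma(G)$-set). A total dominating set of a graph with no isolated vertices is a set $T$ such that every vertex of $G$ has a neighbour in $T$; $\gamma_t(G)$ is its minimum size (a minimum one is a $\gamma_t(G)$-set). A total Roman dominating function (TRD-function) on $G$ is a function $f:V(G)\to\{0,1,2\}$ such that every vertex $v$ with $f(v)=0$ is adjacent to some vertex $u$ with $f(u)=2$, and the subgraph induced by $\{w: f(w)>0\}$ has no isolated vertices; its weight is $\sum_v f(v)$, and $\gamma_{tR}(G)$ is the minimum weight of a TRD-function on $G$. -}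

module Defs where

open import Data.Nat using (ℕ; _≤_)
open import Data.Fin using (Fin; toℕ)
open import Data.Fin.Subset using (Subset; _∈_; ∣_∣)
open import Data.List using (map; allFin)
open import Data.Nat.ListAction using (sum)
open import Data.Product using (Σ; _×_; ∃)
open import Relation.Binary.PropositionalEquality using (_≡_; _≢_)
open import Relation.Nullary using (¬_)
open import Relation.Binary using (Rel; Decidable)
open import Relation.Binary.Construct.Closure.ReflexiveTransitive using (Star)
open import Level using (0ℓ)

record Graph : Set₁ where
  field
    n       : ℕ
    Adj     : Rel (Fin n) 0ℓ
    adj?    : Decidable Adj
    sym     : ∀ {u v} → Adj u v → Adj v u
    irrefl  : ∀ {v} → ¬ Adj v v

open Graph public

module _ (G : Graph) where

  V : Set
  V = Fin (n G)

  Connected : Set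
  Connected = ∀ (u v : V) → Star (Adj G) u v

  IsDominating : Subset (n G) → Set
  IsDominating S = ∀ (v : V) → ¬ (v ∈ S) → ∃ λ u → Adj G v u × u ∈ S

  IsGammaSet : Subset (n G) → Set
  IsGammaSet S = IsDominating S × (∀ S' → IsDominating S' → ∣ S ∣ ≤ ∣ S' ∣)

  IsTotalDominating : Subset (n G) → Set
  IsTotalDominating T = ∀ (v : V) → ∃ λ u → Adj G v u × u ∈ T

  IsGammaTSet : Subset (n G) → Set
  IsGammaTSet T = IsTotalDominating T × (∀ T' → IsTotalDominating T' → ∣ T ∣ ≤ ∣ T' ∣)

  GammaTEq : ℕ → Set
  GammaTEq k = Σ (Subset (n G)) λ T → IsGammaTSet T × ∣ T ∣ ≡ k

  weight : (V → Fin 3) → ℕ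
  weight f = sum (map (λ v → toℕ (f v)) (allFin (n G)))

  IsTRDF : (V → Fin 3) → Set
  IsTRDF f =
    (∀ (v : V) → toℕ (f v) ≡ 0 → ∃ λ u → Adj G v u × toℕ (f u) ≡ 2)
    × (∀ (v : V) → toℕ (f v) ≢ 0 → ∃ λ u → Adj G v u × toℕ (f u) ≢ 0)

  GammaTREq : ℕ → Set
  GammaTREq k = (Σ (V → Fin 3) λ f → IsTRDF f × weight f ≡ k)
              × (∀ f → IsTRDF f → k ≤ weight f)

-- A TRD-function f amounts to a pair D ⊆ P (P = f⁻¹{1,2}, D = f⁻¹(2)) in which D dominates
-- V ∖ P and G[P] has no isolated vertex; its weight is |P| + |D|.  A dominating set S inside a
-- total dominating set T gives the pair (T, S), so γt = 3 together with S ⊂ T yields weight 5,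
-- while the pairs (T, T) show that γtR = 5 forces γt ≥ 3.
-- Under γt ≥ 3 no pair has weight at most 4: always |P| ≥ 3; if D = {v} and a is a neighbour of
-- v in P, then {v, a} is not total dominating, so some b ∈ P has no neighbour in {v, a}, and b
-- with a neighbour c ∈ P gives |P| ≥ 4; if D = ∅ then P = V, and deleting the last vertex q of a
-- growth order of the connected graph (so G − q has no isolated vertex) while giving 2 to a
-- neighbour of q produces a pair of the same weight with |D| = 1.
-- Conversely a pair of weight 5 yields S ⊂ T with |S| = 2, |T| = 3: for |D| = 2 take (D, P); for
-- |D| = 1 (and by the same reduction for |D| = 0) every vertex is v, b, c or a neighbour of v, and
-- a case analysis on the neighbours of c and on an edge leaving {b, c} gives S = {v, q} ⊆ {v, q, p}.

module Submission where

open import Defs hiding (sym)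
open import Data.Nat using (ℕ; zero; suc; _+_; _∸_; _≤_; _<_; z≤n; s≤s)
open import Data.Nat.Properties hiding (_≟_)
open import Data.Bool using (Bool; true; false)
open import Data.Fin using (Fin; zero; suc; toℕ)
open import Data.Fin.Properties using (_≟_)
import Data.Fin.Properties as Fin
open import Data.Fin.Subset using (Subset; _∈_; _∉_; _⊆_; _⊂_; ∣_∣; _∪_; _-_; ⁅_⁆; ∁; ⊥; Nonempty)
open import Data.Fin.Subset.Properties
open import Data.Vec using ([]; _∷_; lookup; tabulate)
open import Data.Vec.Properties using (lookup∘tabulate; []=⇒lookup; lookup⇒[]=)
open import Data.List using (List; []; _∷_; length; allFin)
import Data.List as List
open import Data.List.Properties using (map-tabulate; map-cong)
open import Data.List.Relation.Unary.All as All using (All; []; _∷_)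
open import Data.List.Relation.Unary.All.Properties using (¬Any⇒All¬)
open import Data.List.Relation.Unary.Any using (Any; here; there; any?)
open import Data.List.Relation.Unary.Unique.Propositional using (Unique; []; _∷_)
open import Data.List.Membership.Propositional using (find; lose) renaming (_∈_ to _∈ₗ_; _∉_ to _∉ₗ_)
open import Data.Nat.ListAction using (sum)
open import Data.Product using (Σ; ∃; ∃₂; _×_; _,_; proj₁)
open import Data.Sum using (_⊎_; inj₁; inj₂; [_,_]′)
open import Data.Empty using (⊥-elim)
open import Function using (_∘_; id)
open import Function.Bundles using (_⇔_; mk⇔; Equivalence)
open import Relation.Nullary using (¬_; Dec; yes; no; contradiction)
open import Relation.Nullary.Decidable using (_×-dec_; _⊎-dec_; ¬?)
open import Relation.Binary.PropositionalEquality using (_≡_; _≢_; refl; sym; trans; cong; cong₂; subst)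
open import Relation.Binary.Construct.Closure.ReflexiveTransitive using (Star; ε; _◅_)

private variable m : ℕ

∣p∪q∣≤∣p∣+∣q∣ : (p q : Subset m) → ∣ p ∪ q ∣ ≤ ∣ p ∣ + ∣ q ∣
∣p∪q∣≤∣p∣+∣q∣ [] [] = z≤n
∣p∪q∣≤∣p∣+∣q∣ (true ∷ p) (true ∷ q) =
  s≤s (≤-trans (∣p∪q∣≤∣p∣+∣q∣ p q) (+-monoʳ-≤ ∣ p ∣ (n≤1+n ∣ q ∣)))
∣p∪q∣≤∣p∣+∣q∣ (true ∷ p) (false ∷ q) = s≤s (∣p∪q∣≤∣p∣+∣q∣ p q)
∣p∪q∣≤∣p∣+∣q∣ (false ∷ p) (true ∷ q) =
  ≤-trans (s≤s (∣p∪q∣≤∣p∣+∣q∣ p q)) (≤-reflexive (sym (+-suc ∣ p ∣ ∣ q ∣)))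
∣p∪q∣≤∣p∣+∣q∣ (false ∷ p) (false ∷ q) = ∣p∪q∣≤∣p∣+∣q∣ p q

∣p∣≡0⇒x∉p : ∀ {p : Subset m} {x} → ∣ p ∣ ≡ 0 → x ∉ p
∣p∣≡0⇒x∉p ∣p∣≡0 x∈p = <⇒≢ (≤-trans (s≤s z≤n) (x∈p⇒∣p-x∣<∣p∣ x∈p)) (sym ∣p∣≡0)

nonempty-of-size : ∀ {m} {p : Subset m} → 0 < ∣ p ∣ → Nonempty p
nonempty-of-size {m} {p} 0<∣p∣ with nonempty? p
... | yes ne = ne
... | no empty = contradiction (trans (cong ∣_∣ (Empty-unique empty)) (∣⊥∣≡0 m)) (>⇒≢ 0<∣p∣)

length≤∣p∣ : ∀ {p : Subset m} {xs} → Unique xs → All (_∈ p) xs → length xs ≤ ∣ p ∣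
length≤∣p∣ [] [] = z≤n
length≤∣p∣ {p = p} {x ∷ xs} (x∉xs ∷ unique) (x∈p ∷ xs⊆p) =
  ≤-trans (s≤s (length≤∣p∣ unique xs⊆p-x)) (x∈p⇒∣p-x∣<∣p∣ x∈p)
  where
  xs⊆p-x : All (_∈ p - x) xs
  xs⊆p-x = All.zipWith (λ (x≢y , y∈p) → x∈p∧x≢y⇒x∈p-y y∈p (x≢y ∘ sym)) (x∉xs , xs⊆p)

∈-of-unique-cover : ∀ {p : Subset m} {xs} → Unique xs → All (_∈ p) xs → ∣ p ∣ ≤ length xs →
                    ∀ {x} → x ∈ p → x ∈ₗ xs
∈-of-unique-cover {xs = xs} unique xs⊆p ∣p∣≤ {x} x∈p with any? (x ≟_) xs
... | yes x∈xs = x∈xs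
... | no x∉xs = ⊥-elim (<-irrefl refl (≤-trans (length≤∣p∣ (¬Any⇒All¬ xs x∉xs ∷ unique) (x∈p ∷ xs⊆p)) ∣p∣≤))

∣p∣≤1⇒≡ : ∀ {p : Subset m} {x y} → ∣ p ∣ ≤ 1 → x ∈ p → y ∈ p → x ≡ y
∣p∣≤1⇒≡ {x = x} {y} ∣p∣≤1 x∈p y∈p with x ≟ y
... | yes x≡y = x≡y
... | no x≢y =
  contradiction (≤-trans (length≤∣p∣ ((x≢y ∷ []) ∷ [] ∷ []) (x∈p ∷ y∈p ∷ [])) ∣p∣≤1) λ { (s≤s ()) }

singleton-of-size : ∀ {p : Subset m} → ∣ p ∣ ≡ 1 → ∃ λ v → v ∈ p × (∀ {x} → x ∈ p → x ≡ v)
singleton-of-size {p = p} ∣p∣≡1 with nonempty-of-size {p = p} (≤-reflexive (sym ∣p∣≡1))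
... | v , v∈p = v , v∈p , λ x∈p → ∣p∣≤1⇒≡ (≤-reflexive ∣p∣≡1) x∈p v∈p

2+∣q∣≤∣p∣ : ∀ {p q : Subset m} {x y} → q ⊆ p → x ∈ p → x ∉ q → y ∈ p → y ∉ q → x ≢ y →
            2 + ∣ q ∣ ≤ ∣ p ∣
2+∣q∣≤∣p∣ {p = p} {q} {y = y} q⊆p x∈p x∉q y∈p y∉q x≢y =
  ≤-trans (s≤s (p⊂q⇒∣p∣<∣q∣ (q⊆p-y , _ , x∈p∧x≢y⇒x∈p-y x∈p x≢y , x∉q))) (x∈p⇒∣p-x∣<∣p∣ y∈p)
  where
  q⊆p-y : q ⊆ p - y
  q⊆p-y z∈q = x∈p∧x≢y⇒x∈p-y (q⊆p z∈q) λ { refl → y∉q z∈q }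

⊆∧∣p∣<∣q∣⇒⊂ : ∀ {p q : Subset m} → p ⊆ q → ∣ p ∣ < ∣ q ∣ → p ⊂ q
⊆∧∣p∣<∣q∣⇒⊂ {p = p} {q} p⊆q ∣p∣<∣q∣ with Fin.any? (λ x → x ∈? q ×-dec ¬? (x ∈? p))
... | yes new = p⊆q , new
... | no none = contradiction (p⊆q⇒∣p∣≤∣q∣ q⊆p) (<⇒≱ ∣p∣<∣q∣)
  where
  q⊆p : q ⊆ p
  q⊆p {x} x∈q with x ∈? p
  ... | yes x∈p = x∈p
  ... | no x∉p = contradiction (x , x∈q , x∉p) none

listSet : List (Fin m) → Subset m
listSet [] = ⊥
listSet (x ∷ xs) = ⁅ x ⁆ ∪ listSet xs

∈-listSet : ∀ {x} {xs : List (Fin m)} → x ∈ₗ xs → x ∈ listSet xs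
∈-listSet (here refl) = x∈p∪q⁺ (inj₁ (x∈⁅x⁆ _))
∈-listSet (there x∈xs) = x∈p∪q⁺ (inj₂ (∈-listSet x∈xs))

∣listSet∣≤length : (xs : List (Fin m)) → ∣ listSet xs ∣ ≤ length xs
∣listSet∣≤length {m} [] = ≤-reflexive (∣⊥∣≡0 m)
∣listSet∣≤length (x ∷ xs) =
  ≤-trans (∣p∪q∣≤∣p∣+∣q∣ ⁅ x ⁆ (listSet xs))
          (+-mono-≤ (≤-reflexive (∣⁅x⁆∣≡1 x)) (∣listSet∣≤length xs))

fresh : (xs : List (Fin m)) → length xs < m → ∃ λ t → t ∉ₗ xs
fresh {m} xs length<m with nonempty-of-size {p = ∁ (listSet xs)}
    (subst (0 <_) (sym (∣∁p∣≡n∸∣p∣ (listSet xs))) (m<n⇒0<n∸m (≤-<-trans (∣listSet∣≤length xs) length<m)))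
... | t , t∈∁ = t , x∈∁p⇒x∉p t∈∁ ∘ ∈-listSet

lookup-∉ : ∀ {p : Subset m} {x} → x ∉ p → lookup p x ≡ false
lookup-∉ {p = p} {x} x∉p with lookup p x in eq
... | true = contradiction (lookup⇒[]= x p eq) x∉p
... | false = refl

∈-tabulate⁻ : ∀ {g : Fin m → Bool} {x} → x ∈ tabulate g → g x ≡ true
∈-tabulate⁻ {g = g} {x} x∈ = trans (sym (lookup∘tabulate g x)) ([]=⇒lookup x∈)

∈-tabulate⁺ : ∀ {g : Fin m → Bool} {x} → g x ≡ true → x ∈ tabulate g
∈-tabulate⁺ {g = g} {x} gx≡true = lookup⇒[]= x _ (trans (lookup∘tabulate g x) gx≡true)

suc∣∁⁅x⁆∣≡m : (x : Fin m) → suc ∣ ∁ ⁅ x ⁆ ∣ ≡ m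
suc∣∁⁅x⁆∣≡m {suc m} x = cong suc (trans (∣∁p∣≡n∸∣p∣ ⁅ x ⁆) (cong (suc m ∸_) (∣⁅x⁆∣≡1 x)))

m+n≡o⇒m≡o∸n : ∀ {m n o} → m + n ≡ o → m ≡ o ∸ n
m+n≡o⇒m≡o∸n {m} {n} refl = sym (m+n∸n≡m m n)

5≤m+m⇒3≤m : ∀ m → 5 ≤ m + m → 3 ≤ m
5≤m+m⇒3≤m 0 ()
5≤m+m⇒3≤m 1 (s≤s (s≤s ()))
5≤m+m⇒3≤m 2 (s≤s (s≤s (s≤s (s≤s ()))))
5≤m+m⇒3≤m (suc (suc (suc m))) _ = s≤s (s≤s (s≤s z≤n))

indicatorSum : Bool → Bool → Fin 3
indicatorSum false false = zero
indicatorSum true false = suc zero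
indicatorSum false true = suc zero
indicatorSum true true = suc (suc zero)

sum-indicatorSum : (P D : Subset m) →
  sum (List.tabulate (λ v → toℕ (indicatorSum (lookup P v) (lookup D v)))) ≡ ∣ P ∣ + ∣ D ∣
sum-indicatorSum [] [] = refl
sum-indicatorSum (a ∷ P) (b ∷ D) =
  trans (cong (toℕ (indicatorSum a b) +_) (sum-indicatorSum P D)) (cons a b)
  where
  cons : ∀ a b → toℕ (indicatorSum a b) + (∣ P ∣ + ∣ D ∣) ≡ ∣ a ∷ P ∣ + ∣ b ∷ D ∣
  cons false false = refl
  cons true false = refl
  cons false true = sym (+-suc ∣ P ∣ ∣ D ∣)
  cons true true = cong suc (sym (+-suc ∣ P ∣ ∣ D ∣))

isPositive : Fin 3 → Bool
isPositive zero = false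
isPositive (suc _) = true

isTwo : Fin 3 → Bool
isTwo (suc (suc zero)) = true
isTwo _ = false

indicatorSum-isPositive-isTwo : ∀ k → indicatorSum (isPositive k) (isTwo k) ≡ k
indicatorSum-isPositive-isTwo zero = refl
indicatorSum-isPositive-isTwo (suc zero) = refl
indicatorSum-isPositive-isTwo (suc (suc zero)) = refl

isPositive⇔≢0 : ∀ k → isPositive k ≡ true ⇔ toℕ k ≢ 0
isPositive⇔≢0 zero = mk⇔ (λ ()) (λ 0≢0 → contradiction refl 0≢0)
isPositive⇔≢0 (suc k) = mk⇔ (λ _ ()) (λ _ → refl)

≡0⊎isPositive : ∀ k → toℕ k ≡ 0 ⊎ isPositive k ≡ true
≡0⊎isPositive zero = inj₁ refl
≡0⊎isPositive (suc k) = inj₂ refl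

isTwo⇔≡2 : ∀ k → isTwo k ≡ true ⇔ toℕ k ≡ 2
isTwo⇔≡2 zero = mk⇔ (λ ()) (λ ())
isTwo⇔≡2 (suc zero) = mk⇔ (λ ()) (λ ())
isTwo⇔≡2 (suc (suc zero)) = mk⇔ (λ _ → refl) (λ _ → refl)

crossing-edge : ∀ {A : Set} {R : A → A → Set} {Q : A → Set} → (∀ x → Dec (Q x)) →
                ∀ {s t} → Star R s t → Q s → ¬ Q t → ∃₂ λ x y → Q x × ¬ Q y × R x y
crossing-edge Q? ε Qs ¬Qt = contradiction Qs ¬Qt
crossing-edge Q? (_◅_ {j = y} sRy walk) Qs ¬Qt with Q? y
... | yes Qy = crossing-edge Q? walk Qy ¬Qt
... | no ¬Qy = _ , y , Qs , ¬Qy , sRy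

module _ (G : Graph) where

  infix 4 _~_
  _~_ : V G → V G → Set
  _~_ = Adj G

  _~?_ : ∀ u v → Dec (u ~ v)
  _~?_ = adj? G

  ~-sym : ∀ {u v} → u ~ v → v ~ u
  ~-sym = Graph.sym G

  ~⇒≢ : ∀ {u v} → u ~ v → u ≢ v
  ~⇒≢ u~v refl = irrefl G u~v

  record TRDPair (P D : Subset (n G)) : Set where
    field
      D⊆P : D ⊆ P
      dominated-by-D : ∀ w → w ∉ P → ∃ λ u → w ~ u × u ∈ D
      P-total : ∀ w → w ∈ P → ∃ λ u → w ~ u × u ∈ P

  open TRDPair

  TRDPair⇒total : ∀ {P D} → TRDPair P D → IsTotalDominating G P
  TRDPair⇒total {P} pair w with w ∈? P
  ... | yes w∈P = P-total pair w w∈P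
  ... | no w∉P with dominated-by-D pair w w∉P
  ...   | u , w~u , u∈D = u , w~u , D⊆P pair u∈D

  TRDPair-of-nested : ∀ {S T} → S ⊆ T → IsDominating G S → IsTotalDominating G T → TRDPair T S
  TRDPair-of-nested S⊆T dominating total = record
    { D⊆P = S⊆T
    ; dominated-by-D = λ w w∉T → dominating w (w∉T ∘ S⊆T)
    ; P-total = λ w _ → total w
    }

  roman : Subset (n G) → Subset (n G) → V G → Fin 3
  roman P D v = indicatorSum (lookup P v) (lookup D v)

  weight-roman : ∀ P D → weight G (roman P D) ≡ ∣ P ∣ + ∣ D ∣
  weight-roman P D = trans (cong sum (map-tabulate id (toℕ ∘ roman P D))) (sum-indicatorSum P D)

  TRDPair⇒TRDF : ∀ {P D} → TRDPair P D → IsTRDF G (roman P D)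
  TRDPair⇒TRDF {P} {D} pair = zero⇒adjacent-two , positive⇒adjacent-positive
    where
    positive-on-P : ∀ {v} → v ∈ P → toℕ (roman P D v) ≢ 0
    positive-on-P {v} v∈P rewrite []=⇒lookup v∈P with lookup D v
    ... | false = λ ()
    ... | true = λ ()
    zero⇒adjacent-two : ∀ v → toℕ (roman P D v) ≡ 0 → ∃ λ u → v ~ u × toℕ (roman P D u) ≡ 2
    zero⇒adjacent-two v fv≡0 with v ∈? P
    ... | yes v∈P = contradiction fv≡0 (positive-on-P v∈P)
    ... | no v∉P with dominated-by-D pair v v∉P
    ...   | u , v~u , u∈D =
            u , v~u , cong₂ (λ x y → toℕ (indicatorSum x y)) ([]=⇒lookup (D⊆P pair u∈D)) ([]=⇒lookup u∈D)
    positive⇒adjacent-positive : ∀ v → toℕ (roman P D v) ≢ 0 → ∃ λ u → v ~ u × toℕ (roman P D u) ≢ 0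
    positive⇒adjacent-positive v fv≢0 with v ∈? P
    ... | yes v∈P = let u , v~u , u∈P = P-total pair v v∈P in u , v~u , positive-on-P u∈P
    ... | no v∉P = contradiction
          (cong₂ (λ x y → toℕ (indicatorSum x y)) (lookup-∉ v∉P) (lookup-∉ (v∉P ∘ D⊆P pair))) fv≢0

  positives twos : (V G → Fin 3) → Subset (n G)
  positives f = tabulate (isPositive ∘ f)
  twos f = tabulate (isTwo ∘ f)

  weight≡∣positives∣+∣twos∣ : ∀ f → weight G f ≡ ∣ positives f ∣ + ∣ twos f ∣
  weight≡∣positives∣+∣twos∣ f = trans (cong sum (map-cong (cong toℕ ∘ sym ∘ f≡roman) (allFin (n G))))
                                      (weight-roman (positives f) (twos f))
    where
    f≡roman : ∀ v → roman (positives f) (twos f) v ≡ f v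
    f≡roman v = trans (cong₂ indicatorSum (lookup∘tabulate (isPositive ∘ f) v) (lookup∘tabulate (isTwo ∘ f) v))
                      (indicatorSum-isPositive-isTwo (f v))

  TRDF⇒TRDPair : ∀ {f} → IsTRDF G f → TRDPair (positives f) (twos f)
  TRDF⇒TRDPair {f} (zero⇒adjacent-two , positive⇒adjacent-positive) = record
    { D⊆P = λ v∈twos → ∈-tabulate⁺ (Equivalence.from (isPositive⇔≢0 _) (two⇒≢0 v∈twos))
    ; dominated-by-D = dominated
    ; P-total = λ v v∈P → adjacent (positive⇒adjacent-positive v (positive v∈P))
    }
    where
    positive : ∀ {v} → v ∈ positives f → toℕ (f v) ≢ 0
    positive v∈P = Equivalence.to (isPositive⇔≢0 _) (∈-tabulate⁻ v∈P)
    two⇒≢0 : ∀ {v} → v ∈ twos f → toℕ (f v) ≢ 0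
    two⇒≢0 v∈twos fv≡0 = 0≢1+n (trans (sym fv≡0) (Equivalence.to (isTwo⇔≡2 _) (∈-tabulate⁻ v∈twos)))
    dominated : ∀ v → v ∉ positives f → ∃ λ u → v ~ u × u ∈ twos f
    dominated v v∉P with ≡0⊎isPositive (f v)
    ... | inj₂ isPos = contradiction (∈-tabulate⁺ isPos) v∉P
    ... | inj₁ fv≡0 with zero⇒adjacent-two v fv≡0
    ...   | u , v~u , fu≡2 = u , v~u , ∈-tabulate⁺ (Equivalence.from (isTwo⇔≡2 _) fu≡2)
    adjacent : ∀ {v} → (∃ λ u → v ~ u × toℕ (f u) ≢ 0) → ∃ λ u → v ~ u × u ∈ positives f
    adjacent (u , v~u , fu≢0) = u , v~u , ∈-tabulate⁺ (Equivalence.from (isPositive⇔≢0 _) fu≢0)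

  dominating-listSet : ∀ {xs} → (∀ w → Any (λ u → w ≡ u ⊎ w ~ u) xs) → IsDominating G (listSet xs)
  dominating-listSet near w w∉S with find (near w)
  ... | u , u∈xs , inj₁ refl = contradiction (∈-listSet u∈xs) w∉S
  ... | u , u∈xs , inj₂ w~u = u , w~u , ∈-listSet u∈xs

  total-listSet : ∀ {xs} → (∀ w → Any (w ~_) xs) → IsTotalDominating G (listSet xs)
  total-listSet adjacent w with find (adjacent w)
  ... | u , u∈xs , w~u = u , w~u , ∈-listSet u∈xs

  record NestedDomination (k l : ℕ) : Set where
    field
      S T : Subset (n G)
      S-dominating : IsDominating G S
      T-total : IsTotalDominating G T
      S⊆T : S ⊆ T
      ∣S∣≤k : ∣ S ∣ ≤ k
      ∣T∣≤l : ∣ T ∣ ≤ l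

  nested-of-lists : ∀ p ss → (∀ w → Any (λ u → w ≡ u ⊎ w ~ u) ss) → (∀ w → Any (w ~_) (p ∷ ss)) →
                    NestedDomination (length ss) (suc (length ss))
  nested-of-lists p ss near adjacent = record
    { S = listSet ss
    ; T = listSet (p ∷ ss)
    ; S-dominating = dominating-listSet near
    ; T-total = total-listSet adjacent
    ; S⊆T = q⊆p∪q ⁅ p ⁆ (listSet ss)
    ; ∣S∣≤k = ∣listSet∣≤length ss
    ; ∣T∣≤l = ∣listSet∣≤length (p ∷ ss)
    }

  γt≥ : ℕ → Set
  γt≥ k = ∀ T → IsTotalDominating G T → k ≤ ∣ T ∣

  no-total-pair : γt≥ 3 → ∀ x y → ¬ (∀ w → Any (w ~_) (x ∷ y ∷ []))
  no-total-pair γt≥3 x y adjacent =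
    contradiction (≤-trans (γt≥3 _ (total-listSet adjacent)) (∣listSet∣≤length (x ∷ y ∷ []))) λ { (s≤s (s≤s ())) }

  non-neighbour : γt≥ 3 → ∀ x y → ∃ λ b → ¬ (b ~ x ⊎ b ~ y)
  non-neighbour γt≥3 x y with Fin.all? (λ w → (w ~? x) ⊎-dec (w ~? y))
  ... | yes adjacent = contradiction (λ w → [ here , there ∘ here ]′ (adjacent w)) (no-total-pair γt≥3 x y)
  ... | no ¬adjacent = Fin.¬∀⟶∃¬ _ _ (λ w → (w ~? x) ⊎-dec (w ~? y)) ¬adjacent

  grow : Connected G → ∀ {x xs} → x ∈ₗ xs → length xs < n G → ∃₂ λ q p → q ∉ₗ xs × p ∈ₗ xs × q ~ p
  grow connected {x} {xs} x∈xs length<n with fresh xs length<n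
  ... | t , t∉xs with crossing-edge (λ y → any? (y ≟_) xs) (connected x t) x∈xs t∉xs
  ...   | p , q , p∈xs , q∉xs , p~q = q , p , q∉xs , p∈xs , ~-sym p~q

  neighbour : Connected G → 2 ≤ n G → ∀ s → ∃ λ u → u ~ s
  neighbour connected 2≤n s with grow connected {xs = s ∷ []} (here refl) 2≤n
  ... | u , _ , _ , here refl , u~s = u , u~s
  ... | _ , _ , _ , there () , _

  dominating-nonempty : 1 ≤ n G → ∀ {S} → IsDominating G S → Nonempty S
  dominating-nonempty 1≤n {S} dominating with fresh [] 1≤n
  ... | v , _ with v ∈? S
  ...   | yes v∈S = v , v∈S
  ...   | no v∉S = let u , _ , u∈S = dominating v v∉S in u , u∈S

  γ≥2 : Connected G → 2 ≤ n G → γt≥ 3 → ∀ S → IsDominating G S → 2 ≤ ∣ S ∣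
  γ≥2 connected 2≤n γt≥3 S dominating with 2 ≤? ∣ S ∣
  ... | yes 2≤∣S∣ = 2≤∣S∣
  ... | no 2≰∣S∣ with dominating-nonempty (≤-trans (s≤s z≤n) 2≤n) dominating
  ...   | s , s∈S with neighbour connected 2≤n s
  ...     | u , u~s = contradiction adjacent (no-total-pair γt≥3 s u)
    where
    S≡s : ∀ {x} → x ∈ S → x ≡ s
    S≡s x∈S = ∣p∣≤1⇒≡ (≤-pred (≰⇒> 2≰∣S∣)) x∈S s∈S
    adjacent : ∀ w → Any (w ~_) (s ∷ u ∷ [])
    adjacent w with w ≟ s
    ... | yes refl = there (here (~-sym u~s))
    ... | no w≢s = let y , w~y , y∈S = dominating w (w≢s ∘ S≡s) in here (subst (w ~_) (S≡s y∈S) w~y)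

  NoIsolatedIn : List (V G) → Set
  NoIsolatedIn xs = ∀ {x} → x ∈ₗ xs → Any (x ~_) xs

  no-isolated-list : Connected G → ∀ k → suc (suc k) ≤ n G →
                     ∃ λ xs → Unique xs × length xs ≡ suc (suc k) × NoIsolatedIn xs
  no-isolated-list connected zero 2≤n with fresh [] (≤-trans (s≤s z≤n) 2≤n)
  ... | s , _ with neighbour connected 2≤n s
  ...   | u , u~s = u ∷ s ∷ [] , (~⇒≢ u~s ∷ []) ∷ [] ∷ [] , refl ,
                    λ { (here refl) → there (here u~s) ; (there (here refl)) → here (~-sym u~s) }
  no-isolated-list connected (suc k) k+3≤n with no-isolated-list connected k (≤-trans (n≤1+n _) k+3≤n)
  ... | xs@(x ∷ _) , unique , length≡ , no-isolated
      with grow connected (here refl) (subst (λ l → suc l ≤ n G) (sym length≡) k+3≤n)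
  ...   | q , p , q∉xs , p∈xs , q~p =
          q ∷ xs , ¬Any⇒All¬ xs q∉xs ∷ unique , cong suc length≡ ,
          λ { (here refl) → there (lose p∈xs q~p) ; (there x∈xs) → there (no-isolated x∈xs) }

  vertex-deletion : Connected G → 3 ≤ n G → ∃₂ λ q p → TRDPair (∁ ⁅ q ⁆) ⁅ p ⁆
  vertex-deletion connected 3≤n with m≤n⇒∃[o]m+o≡n 3≤n
  ... | k , 3+k≡n with no-isolated-list connected k (subst (2 + k ≤_) 3+k≡n (n≤1+n _))
  ...   | xs@(x ∷ _) , unique , length≡ , no-isolated
        with grow connected (here refl) (subst (λ l → suc l ≤ n G) (sym length≡) (≤-reflexive 3+k≡n))
  ...     | q , p , q∉xs , p∈xs , q~p = q , p , record
            { D⊆P = λ x∈⁅p⁆ → subst (_∈ ∁ ⁅ q ⁆) (sym (x∈⁅y⁆⇒x≡y p x∈⁅p⁆)) (∉⁅q⁆⇒∈∁ p≢q)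
            ; dominated-by-D = λ w w∉∁ →
                p , subst (_~ p) (sym (x∈⁅y⁆⇒x≡y q (x∉∁p⇒x∈p w∉∁))) q~p , x∈⁅x⁆ p
            ; P-total = total
            }
    where
    ∉⁅q⁆⇒∈∁ : ∀ {w} → w ≢ q → w ∈ ∁ ⁅ q ⁆
    ∉⁅q⁆⇒∈∁ w≢q = x∉p⇒x∈∁p (x≢y⇒x∉⁅y⁆ w≢q)
    p≢q : p ≢ q
    p≢q = ~⇒≢ (~-sym q~p)
    all-but-q-in-xs : ∀ {w} → w ≢ q → w ∈ₗ xs
    all-but-q-in-xs w≢q with ∈-of-unique-cover (¬Any⇒All¬ xs q∉xs ∷ unique) (All.universal (λ _ → ∈⊤) (q ∷ xs))
                               (≤-reflexive (trans (∣⊤∣≡n (n G)) (trans (sym 3+k≡n) (cong suc (sym length≡))))) ∈⊤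
    ... | here w≡q = contradiction w≡q w≢q
    ... | there w∈xs = w∈xs
    total : ∀ w → w ∈ ∁ ⁅ q ⁆ → ∃ λ u → w ~ u × u ∈ ∁ ⁅ q ⁆
    total w w∈∁ with find (no-isolated (all-but-q-in-xs (x∉⁅y⁆⇒x≢y (x∈∁p⇒x∉p w∈∁))))
    ... | u , u∈xs , w~u = u , w~u , ∉⁅q⁆⇒∈∁ λ { refl → q∉xs u∈xs }

  data Near (v b c : V G) : V G → Set where
    at-v : Near v b c v
    at-b : Near v b c b
    at-c : Near v b c c
    adj-v : ∀ {w} → w ~ v → Near v b c w

  near-swap : ∀ {v b c w} → Near v b c w → Near v c b w
  near-swap at-v = at-v
  near-swap at-b = at-c
  near-swap at-c = at-b
  near-swap (adj-v w~v) = adj-v w~v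

  nested-of-near : ∀ {v p q r} → v ~ p → q ~ r → q ~ p ⊎ q ~ v → (∀ w → Near v q r w) → NestedDomination 2 3
  nested-of-near {v} {p} {q} {r} v~p q~r q~p⊎q~v near = nested-of-lists p (v ∷ q ∷ []) dominated adjacent
    where
    dominated : ∀ w → Any (λ u → w ≡ u ⊎ w ~ u) (v ∷ q ∷ [])
    dominated w with near w
    ... | at-v = here (inj₁ refl)
    ... | at-b = there (here (inj₁ refl))
    ... | at-c = there (here (inj₂ (~-sym q~r)))
    ... | adj-v w~v = here (inj₂ w~v)
    adjacent : ∀ w → Any (w ~_) (p ∷ v ∷ q ∷ [])
    adjacent w with near w
    ... | at-v = here v~p
    ... | at-b = [ here , there ∘ here ]′ q~p⊎q~v
    ... | at-c = there (there (here (~-sym q~r)))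
    ... | adj-v w~v = there (here w~v)

  nested-of-near-edge : Connected G → ∀ {v a b c} → v ~ a → b ~ c → ¬ b ~ v → (∀ w → Near v b c w) →
                        NestedDomination 2 3
  nested-of-near-edge connected {v} {a} {b} {c} v~a b~c b≁v near with c ~? v | c ~? a
  ... | yes c~v | _ = nested-of-near v~a (~-sym b~c) (inj₂ c~v) (near-swap ∘ near)
  ... | no _ | yes c~a = nested-of-near v~a (~-sym b~c) (inj₁ c~a) (near-swap ∘ near)
  ... | no c≁v | no c≁a
      with crossing-edge (λ x → (x ≟ b) ⊎-dec (x ≟ c)) (connected b v) (inj₁ refl)
                         (λ { (inj₁ refl) → c≁v (~-sym b~c) ; (inj₂ refl) → c≁a v~a })
  ...   | x , y , x∈bc , y∉bc , x~y with near y | x∈bc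
  ...     | at-v | inj₁ refl = contradiction x~y b≁v
  ...     | at-v | inj₂ refl = contradiction x~y c≁v
  ...     | at-b | _ = contradiction (inj₁ refl) y∉bc
  ...     | at-c | _ = contradiction (inj₂ refl) y∉bc
  ...     | adj-v y~v | inj₁ refl = nested-of-near (~-sym y~v) b~c (inj₁ x~y) near
  ...     | adj-v y~v | inj₂ refl = nested-of-near (~-sym y~v) (~-sym b~c) (inj₁ x~y) (near-swap ∘ near)

  record Quartet (P : Subset (n G)) : Set where
    field
      v a b c : V G
      outside-adj : ∀ w → w ∉ P → w ~ v
      v~a : v ~ a
      b~c : b ~ c
      b≁v : ¬ b ~ v
      distinct : Unique (v ∷ a ∷ b ∷ c ∷ [])
      in-P : All (_∈ P) (v ∷ a ∷ b ∷ c ∷ [])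

  outside-adj-of-singleton : ∀ {P D v} → TRDPair P D → (∀ {u} → u ∈ D → u ≡ v) → ∀ w → w ∉ P → w ~ v
  outside-adj-of-singleton pair D≡v w w∉P with dominated-by-D pair w w∉P
  ... | u , w~u , u∈D = subst (w ~_) (D≡v u∈D) w~u

  quartet : ∀ {P D} → γt≥ 3 → TRDPair P D → ∣ D ∣ ≡ 1 → Quartet P
  quartet {P} γt≥3 pair ∣D∣≡1 with singleton-of-size ∣D∣≡1
  ... | v , v∈D , D≡v with P-total pair v (D⊆P pair v∈D)
  ...   | a , v~a , a∈P with non-neighbour γt≥3 v a
  ...     | b , b≁v⊎a with b ∈? P
  ...       | no b∉P = contradiction (inj₁ (outside-adj-of-singleton pair D≡v b b∉P)) b≁v⊎a
  ...       | yes b∈P with P-total pair b b∈P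
  ...         | c , b~c , c∈P = record
                { v = v ; a = a ; b = b ; c = c
                ; outside-adj = outside-adj-of-singleton pair D≡v
                ; v~a = v~a
                ; b~c = b~c
                ; b≁v = b≁v⊎a ∘ inj₁
                ; distinct = (~⇒≢ v~a ∷ (λ { refl → b≁v⊎a (inj₂ v~a) })
                                       ∷ (λ { refl → b≁v⊎a (inj₁ b~c) }) ∷ [])
                           ∷ ((λ { refl → b≁v⊎a (inj₁ (~-sym v~a)) }) ∷ (λ { refl → b≁v⊎a (inj₂ b~c) }) ∷ [])
                           ∷ (~⇒≢ b~c ∷ []) ∷ [] ∷ []
                ; in-P = D⊆P pair v∈D ∷ a∈P ∷ b∈P ∷ c∈P ∷ []
                }

  4≤∣P∣ : ∀ {P D} → γt≥ 3 → TRDPair P D → ∣ D ∣ ≡ 1 → 4 ≤ ∣ P ∣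
  4≤∣P∣ γt≥3 pair ∣D∣≡1 = length≤∣p∣ distinct in-P
    where open Quartet (quartet γt≥3 pair ∣D∣≡1)

  nested-of-singleton : Connected G → ∀ {P D} → γt≥ 3 → TRDPair P D → ∣ D ∣ ≡ 1 → ∣ P ∣ ≤ 4 →
                        NestedDomination 2 3
  nested-of-singleton connected {P} γt≥3 pair ∣D∣≡1 ∣P∣≤4 = nested-of-near-edge connected v~a b~c b≁v near
    where
    open Quartet (quartet γt≥3 pair ∣D∣≡1)
    near : ∀ w → Near v b c w
    near w with w ∈? P
    ... | no w∉P = adj-v (outside-adj w w∉P)
    ... | yes w∈P with ∈-of-unique-cover distinct in-P ∣P∣≤4 w∈P
    ...   | here refl = at-v
    ...   | there (here refl) = adj-v (~-sym v~a)
    ...   | there (there (here refl)) = at-b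
    ...   | there (there (there (here refl))) = at-c

  dominating-of-small-P : ∀ {P D} → TRDPair P D → ∣ P ∣ ≤ suc ∣ D ∣ → IsDominating G D
  dominating-of-small-P {P} {D} pair ∣P∣≤1+∣D∣ w w∉D with w ∈? P
  ... | no w∉P = dominated-by-D pair w w∉P
  ... | yes w∈P with P-total pair w w∈P
  ...   | u , w~u , u∈P with u ∈? D
  ...     | yes u∈D = u , w~u , u∈D
  ...     | no u∉D = contradiction
              (≤-trans (2+∣q∣≤∣p∣ (D⊆P pair) w∈P w∉D u∈P u∉D (~⇒≢ w~u)) ∣P∣≤1+∣D∣)
              (<-irrefl refl ∘ ≤-pred)

  ∣P∣≡n : ∀ {P D} → TRDPair P D → ∣ D ∣ ≡ 0 → ∣ P ∣ ≡ n G
  ∣P∣≡n {P} pair ∣D∣≡0 = trans (cong ∣_∣ (⊆-antisym ⊆⊤ (λ {w} _ → in-P w))) (∣⊤∣≡n (n G))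
    where
    in-P : ∀ w → w ∈ P
    in-P w with w ∈? P
    ... | yes w∈P = w∈P
    ... | no w∉P = let _ , _ , u∈D = dominated-by-D pair w w∉P in contradiction u∈D (∣p∣≡0⇒x∉p ∣D∣≡0)

  pair-with-singleton-twos : Connected G → ∀ {P D} → γt≥ 3 → TRDPair P D → ∣ D ∣ ≡ 0 →
                             ∃₂ λ P′ D′ → TRDPair P′ D′ × ∣ D′ ∣ ≡ 1 × suc ∣ P′ ∣ ≡ ∣ P ∣
  pair-with-singleton-twos connected {P} γt≥3 pair ∣D∣≡0
    with vertex-deletion connected (subst (3 ≤_) (∣P∣≡n pair ∣D∣≡0) (γt≥3 P (TRDPair⇒total pair)))
  ... | q , p , pair′ = ∁ ⁅ q ⁆ , ⁅ p ⁆ , pair′ , ∣⁅x⁆∣≡1 p ,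
        trans (suc∣∁⁅x⁆∣≡m q) (sym (∣P∣≡n pair ∣D∣≡0))

  weight≥5 : Connected G → ∀ {P D} → γt≥ 3 → TRDPair P D → 5 ≤ ∣ P ∣ + ∣ D ∣
  weight≥5 connected {P} {D} γt≥3 pair with ∣ D ∣ in ∣D∣≡
  ... | suc (suc k) = +-mono-≤ (γt≥3 P (TRDPair⇒total pair)) (s≤s (s≤s z≤n))
  ... | 1 = +-monoˡ-≤ 1 (4≤∣P∣ γt≥3 pair ∣D∣≡)
  ... | 0 with pair-with-singleton-twos connected γt≥3 pair ∣D∣≡
  ...   | P′ , D′ , pair′ , ∣D′∣≡1 , 1+∣P′∣≡∣P∣ =
          subst (5 ≤_) (trans 1+∣P′∣≡∣P∣ (sym (+-identityʳ ∣ P ∣))) (s≤s (4≤∣P∣ γt≥3 pair′ ∣D′∣≡1))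

  nested-of-weight5 : Connected G → ∀ {P D} → γt≥ 3 → TRDPair P D → ∣ P ∣ + ∣ D ∣ ≡ 5 → NestedDomination 2 3
  nested-of-weight5 connected {P} {D} γt≥3 pair weight≡5 with ∣ D ∣ in ∣D∣≡
  ... | suc (suc (suc k)) = ⊥-elim (<-irrefl refl (subst (6 ≤_) weight≡5 (+-mono-≤ 3≤∣P∣ (s≤s (s≤s (s≤s z≤n))))))
    where
    3≤∣P∣ : 3 ≤ ∣ P ∣
    3≤∣P∣ = ≤-trans (≤-trans (s≤s (s≤s (s≤s z≤n))) (≤-reflexive (sym ∣D∣≡)))
                    (p⊆q⇒∣p∣≤∣q∣ (D⊆P pair))
  ... | 2 = record
    { S = D
    ; T = P
    ; S-dominating = dominating-of-small-P pair (subst (λ k → ∣ P ∣ ≤ suc k) (sym ∣D∣≡) ∣P∣≤3)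
    ; T-total = TRDPair⇒total pair
    ; S⊆T = D⊆P pair
    ; ∣S∣≤k = ≤-reflexive ∣D∣≡
    ; ∣T∣≤l = ∣P∣≤3
    }
    where
    ∣P∣≤3 : ∣ P ∣ ≤ 3
    ∣P∣≤3 = ≤-reflexive (m+n≡o⇒m≡o∸n weight≡5)
  ... | 1 = nested-of-singleton connected γt≥3 pair ∣D∣≡ (≤-reflexive (m+n≡o⇒m≡o∸n weight≡5))
  ... | 0 with pair-with-singleton-twos connected γt≥3 pair ∣D∣≡
  ...   | P′ , D′ , pair′ , ∣D′∣≡1 , 1+∣P′∣≡∣P∣ =
          nested-of-singleton connected γt≥3 pair′ ∣D′∣≡1
            (≤-pred (≤-reflexive (trans 1+∣P′∣≡∣P∣ (m+n≡o⇒m≡o∸n weight≡5))))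

  forward : Connected G → 2 ≤ n G → GammaTREq G 5 →
            GammaTEq G 3 × Σ _ λ S → Σ _ λ T → IsGammaSet G S × IsGammaTSet G T × S ⊂ T
  forward connected 2≤n ((f , trdf , weight≡5) , minimal) =
    (T , γt-set , ≤-antisym ∣T∣≤l (γt≥3 T T-total)) ,
    S , T , (S-dominating , λ S′ → ≤-trans ∣S∣≤k ∘ γ≥2 connected 2≤n γt≥3 S′) , γt-set ,
    ⊆∧∣p∣<∣q∣⇒⊂ S⊆T (≤-trans (s≤s ∣S∣≤k) (γt≥3 T T-total))
    where
    γt≥3 : γt≥ 3
    γt≥3 T′ total = 5≤m+m⇒3≤m ∣ T′ ∣ (subst (5 ≤_) (weight-roman T′ T′)
                      (minimal _ (TRDPair⇒TRDF (TRDPair-of-nested id (λ w _ → total w) total))))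
    open NestedDomination (nested-of-weight5 connected γt≥3 (TRDF⇒TRDPair trdf)
                             (trans (sym (weight≡∣positives∣+∣twos∣ f)) weight≡5))
    γt-set : IsGammaTSet G T
    γt-set = T-total , λ T′ → ≤-trans ∣T∣≤l ∘ γt≥3 T′

  backward : Connected G → 2 ≤ n G →
             GammaTEq G 3 × Σ _ (λ S → Σ _ λ T → IsGammaSet G S × IsGammaTSet G T × S ⊂ T) →
             GammaTREq G 5
  backward connected 2≤n
           ((T₀ , (T₀-total , T₀-minimal) , ∣T₀∣≡3) , S , T , (S-dominating , _) , (T-total , T-minimal) , S⊂T) =
    (roman T S , TRDPair⇒TRDF pair , trans (weight-roman T S) (cong₂ _+_ ∣T∣≡3 ∣S∣≡2)) ,
    λ f trdf → subst (5 ≤_) (sym (weight≡∣positives∣+∣twos∣ f)) (weight≥5 connected γt≥3 (TRDF⇒TRDPair trdf))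
    where
    γt≥3 : γt≥ 3
    γt≥3 T′ total = subst (_≤ ∣ T′ ∣) ∣T₀∣≡3 (T₀-minimal T′ total)
    ∣T∣≡3 : ∣ T ∣ ≡ 3
    ∣T∣≡3 = ≤-antisym (subst (∣ T ∣ ≤_) ∣T₀∣≡3 (T-minimal T₀ T₀-total)) (γt≥3 T T-total)
    ∣S∣≡2 : ∣ S ∣ ≡ 2
    ∣S∣≡2 = ≤-antisym (≤-pred (subst (∣ S ∣ <_) ∣T∣≡3 (p⊂q⇒∣p∣<∣q∣ S⊂T)))
                      (γ≥2 connected 2≤n γt≥3 S S-dominating)
    pair : TRDPair T S
    pair = TRDPair-of-nested (proj₁ S⊂T) S-dominating T-total

theorem5p2 : (G : Graph) → 2 ≤ n G → Connected G →
    (GammaTREq G 5 ⇔ (GammaTEq G 3 × Σ _ λ S → Σ _ λ T → IsGammaSet G S × IsGammaTSet G T × S ⊂ T))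
theorem5p2 G 2≤n connected = mk⇔ (forward G connected 2≤n) (backward G connected 2≤n)
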